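{- Let $B$ be a Boolean algebra with an $M$-ideal $I$, and for each positive integer $n$ let $C_n=\{a\in B^+ : a\neq a_n \text{ for every } \{a_j\}_j\in I\}$. Then for every $n$ there exists $k>n$ such that for every $c\in C_n$ and all $a,b\in B$, if $c=a\cup b$ then $a\in C_k$ or $b\in C_k$.
   Context: A Boolean algebra here is an algebra $B$ of subsets of a nonempty set $S$ with operations $\cup,\cap$, complement, $\mathbf 0=\emptyset$, $\mathbf 1=S$, and $a\le b$ iff $a\subseteq b$; $B^+=B\setminus\{\mathbf 0\}$. An antichain is a set of pairwise disjoint elements of $B^+$. Sequences are indexed by positive integers. A set $I$ of infinite sequences in $B^+$ is an $M$-ideal if: (M1) if $\{a_n\}_n\in I$ then there is no $a>\mathbf 0$ with $a\le a_n$ for all $n$; (M2) if $s\in I$ and $t$ is an infinite subsequence of $s$ then $t\in I$; (M3) if $\{a_n\}_n\in I$ and $b_n\in B^+$ with $b_n\le a_n$ for all $n$ then $\{b_n\}_n\in I$; (M4) if $\{a_n\}_n,\{b_n\}_n\in I$ then $\{a_n\cup b_n\}_n$ has an infinite subsequence in $I$; (M5) if $\{a^k_n\}_n\in I$ for every $k$, then $\{a^n_n\}_n\in I$; (M6) if for every $n$, $A_n$ is a finite antichain with $|A_n|\ge n$, then there exist $a_n\in A_n$ with $\{a_n\}_n\in I$. -}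

module Defs where

open import Level using (Level; _⊔_) renaming (suc to lsuc)
open import Algebra.Lattice.Bundles using (BooleanAlgebra)
open import Data.Nat using (ℕ; suc; _<_; _≤_)
open import Data.List using (List; length; lookup)
open import Data.List.Membership.Propositional using (_∈_)
open import Data.Fin using (Fin)
open import Data.Product using (Σ; ∃; _×_)
open import Relation.Nullary using (¬_)
open import Relation.Binary.PropositionalEquality using (_≢_)

-- Sequences indexed by positive
-- integers are functions ℕ → Carrier, where  s i  is the term a_{i+1}.

module _ {c ℓ : Level} (B : BooleanAlgebra c ℓ) where
  open BooleanAlgebra B renaming (⊥ to 𝟘; ¬_ to ∁_)

  _≤ᴮ_ : Carrier → Carrier → Set ℓ
  a ≤ᴮ b = (a ∧ b) ≈ a

  Pos : Carrier → Set ℓ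
  Pos a = ¬ (a ≈ 𝟘)

  Seq : Set c
  Seq = ℕ → Carrier

  StrictlyIncreasing : (ℕ → ℕ) → Set
  StrictlyIncreasing f = ∀ n → f n < f (suc n)

  Subseq : Seq → Seq → Set ℓ
  Subseq t s = Σ (ℕ → ℕ) λ f → StrictlyIncreasing f × (∀ n → t n ≈ s (f n))

  Antichain : List Carrier → Set ℓ
  Antichain A = (∀ i → Pos (lookup A i))
              × (∀ (i j : Fin (length A)) → i ≢ j → (lookup A i ∧ lookup A j) ≈ 𝟘)

  record MIdeal {ℓ′ : Level} (I : Seq → Set ℓ′) : Set (c ⊔ ℓ ⊔ ℓ′) where
    field
      inB⁺ : ∀ s → I s → ∀ n → Pos (s n)
      M1 : ∀ s → I s → ¬ (Σ Carrier λ a → Pos a × (∀ n → a ≤ᴮ s n))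
      M2 : ∀ s t → I s → Subseq t s → I t
      M3 : ∀ s (b : Seq) → I s → (∀ n → Pos (b n)) → (∀ n → b n ≤ᴮ s n) → I b
      M4 : ∀ s t → I s → I t → Σ Seq λ u → Subseq u (λ n → s n ∨ t n) × I u
      M5 : (a : ℕ → Seq) → (∀ k → I (a k)) → I (λ n → a n n)
      -- A i is A_{i+1}, required to have size ≥ i+1
      M6 : (A : ℕ → List Carrier) → (∀ i → Antichain (A i)) → (∀ i → suc i ≤ length (A i))
         → Σ Seq λ a → (∀ i → a i ∈ A i) × I a

  -- C i  is  C_{i+1} = { a ∈ B⁺ : a ≠ a_{i+1} for every {a_j} ∈ I }
  C : {ℓ′ : Level} → (Seq → Set ℓ′) → ℕ → Carrier → Set (c ⊔ ℓ ⊔ ℓ′)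
  C I i a = Pos a × (∀ s → I s → ¬ (a ≈ s i))

module Submission where

-- Say that a occurs at level k when a ≈ s k for some s ∈ I,
-- so that C k consists of the nonzero elements not occurring at level k.
-- Shifting sequences (M2) shows that occurring at level k implies
-- occurring at every lower level, hence C n ⊆ C k for n ≤ k.
-- Classically, if c ∈ C n splits as c ≈ a ∨ b and neither part lies in
-- C k (n ≤ k), then both a and b occur at level k: a part that does not
-- occur must be zero, and then the other part equals c up to ≈.
-- Suppose the theorem fails for n.  Then for every j there is a split
-- c_j ≈ a_j ∨ b_j with c_j ∈ C n and a_j, b_j occurring at level
-- suc n + j, hence at level j.  The diagonal principle M5 turns
-- {a_j} and {b_j} into members of I (up to ≈), and M4 yields a
-- subsequence g of {a_j ∨ b_j} lying in I.  Then c_(g n) ≈ a_(g n) ∨ b_(g n)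
-- occurs at level n, contradicting c_(g n) ∈ C n.

open import Defs
open import Level using (Level; _⊔_)
open import Algebra.Lattice.Bundles using (BooleanAlgebra)
open import Axiom.ExcludedMiddle using (ExcludedMiddle)
open import Axiom.DoubleNegationElimination using (em⇒dne)
open import Data.Nat using (ℕ; _<_; _≤_; _+_; _∸_; suc; s≤s)
open import Data.Nat.Properties using (n<1+n; m+[n∸m]≡n; m≤n+m; m≤m+n; <⇒≤)
open import Data.Product using (Σ; _×_; _,_; proj₁; proj₂)
open import Data.Sum using (_⊎_; inj₁; inj₂)
open import Data.Empty using (⊥-elim)
open import Function using (_∘_)
open import Relation.Nullary using (¬_; yes; no)
import Relation.Binary.PropositionalEquality as ≡
import Algebra.Lattice.Properties.BooleanAlgebra as BooleanAlgebraProperties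

module Development {c ℓ ℓ′ : Level} (B : BooleanAlgebra c ℓ)
  (I : Seq B → Set ℓ′) (M : MIdeal B I) where
  open BooleanAlgebra B renaming (⊥ to 𝟘; ¬_ to ∁_)
  open BooleanAlgebraProperties B using (∨-identityˡ)
  open MIdeal M

  Occurs : ℕ → Carrier → Set (c ⊔ ℓ ⊔ ℓ′)
  Occurs k a = Σ (Seq B) λ s → I s × a ≈ s k

  Occurs-resp : ∀ {k a b} → a ≈ b → Occurs k b → Occurs k a
  Occurs-resp a≈b (s , s∈I , b≈sk) = s , s∈I , trans a≈b b≈sk

  drop-∈I : ∀ d s → I s → I (λ i → s (i + d))
  drop-∈I d s s∈I = M2 s _ s∈I ((λ i → i + d) , (λ i → n<1+n (i + d)) , λ _ → refl)

  Occurs-down : ∀ {j k a} → j ≤ k → Occurs k a → Occurs j a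
  Occurs-down {j} {k} {a} j≤k (s , s∈I , a≈sk) =
    (λ i → s (i + (k ∸ j))) , drop-∈I (k ∸ j) s s∈I ,
    ≡.subst (λ m → a ≈ s m) (≡.sym (m+[n∸m]≡n j≤k)) a≈sk

  C⇒¬Occurs : ∀ {k x} → C B I k x → ¬ Occurs k x
  C⇒¬Occurs (_ , x∉) (s , s∈I , x≈sk) = x∉ s s∈I x≈sk

  ¬Occurs⇒C : ∀ {k x} → Pos B x → ¬ Occurs k x → C B I k x
  ¬Occurs⇒C x≢𝟘 x∉ = x≢𝟘 , λ s s∈I x≈sk → x∉ (s , s∈I , x≈sk)

  C-mono : ∀ {n k x} → n ≤ k → C B I n x → C B I k x
  C-mono n≤k x∈C = ¬Occurs⇒C (proj₁ x∈C) (C⇒¬Occurs x∈C ∘ Occurs-down n≤k)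

  -- Membership in C k only needs the equality to hold up to double negation,
  -- since both of its components are negative statements.
  C-resp-¬¬ : ∀ {k x y} → ¬ ¬ (x ≈ y) → C B I k x → C B I k y
  C-resp-¬¬ ¬¬x≈y (x≢𝟘 , x∉) =
      (λ y≈𝟘 → ¬¬x≈y λ x≈y → x≢𝟘 (trans x≈y y≈𝟘))
    , (λ s s∈I y≈sk → ¬¬x≈y λ x≈y → x∉ s s∈I (trans x≈y y≈sk))

  ¬¬-absorb : ∀ {x a b} → x ≈ a ∨ b → ¬ Pos B a → ¬ ¬ (x ≈ b)
  ¬¬-absorb x≈a∨b ¬a≢𝟘 ¬x≈b =
    ¬a≢𝟘 λ a≈𝟘 → ¬x≈b (trans x≈a∨b (trans (∨-cong a≈𝟘 refl) (∨-identityˡ _)))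

  -- A split at levels (n, k): an element of C n written as a join of two
  -- elements both occurring at level k.  These are the obstructions to the
  -- theorem at level k.
  record Split (n k : ℕ) : Set (c ⊔ ℓ ⊔ ℓ′) where
    field
      whole left right : Carrier
      whole∈C : C B I n whole
      whole≈ : whole ≈ left ∨ right
      left-occurs : Occurs k left
      right-occurs : Occurs k right

  _∈I≈ : Seq B → Set (c ⊔ ℓ ⊔ ℓ′)
  a ∈I≈ = Σ (Seq B) λ s → I s × (∀ j → a j ≈ s j)

  diagonal : (a : Seq B) → (∀ j → Occurs j (a j)) → a ∈I≈
  diagonal a occurs =
      (λ j → proj₁ (occurs j) j)
    , M5 (λ j → proj₁ (occurs j)) (λ j → proj₁ (proj₂ (occurs j)))
    , (λ j → proj₂ (proj₂ (occurs j)))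

  join-occurs : ∀ {a b} → a ∈I≈ → b ∈I≈
              → Σ (ℕ → ℕ) λ g → ∀ i → Occurs i (a (g i) ∨ b (g i))
  join-occurs (s , s∈I , a≈s) (t , t∈I , b≈t) with M4 s t s∈I t∈I
  ... | u , (g , _ , u≈s∨t) , u∈I =
    g , λ i → u , u∈I , trans (∨-cong (a≈s (g i)) (b≈t (g i))) (sym (u≈s∨t i))

  -- Splits cannot exist at levels k_j ≥ j for every j: the diagonal of
  -- their parts would put some split element of C n at level n.
  no-splits-forever : ∀ n (k : ℕ → ℕ) → (∀ j → j ≤ k j) → ¬ (∀ j → Split n (k j))
  no-splits-forever n k j≤k split =
    C⇒¬Occurs (whole∈C (split (g n))) (Occurs-resp (whole≈ (split (g n))) (occurs n))
    where
    open Split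
    left-seq right-seq : Seq B
    left-seq j = left (split j)
    right-seq j = right (split j)
    joined : Σ (ℕ → ℕ) λ g → ∀ i → Occurs i (left-seq (g i) ∨ right-seq (g i))
    joined = join-occurs
      (diagonal left-seq λ j → Occurs-down (j≤k j) (left-occurs (split j)))
      (diagonal right-seq λ j → Occurs-down (j≤k j) (right-occurs (split j)))
    g : ℕ → ℕ
    g = proj₁ joined
    occurs : ∀ i → Occurs i (left-seq (g i) ∨ right-seq (g i))
    occurs = proj₂ joined

  Good : ℕ → ℕ → Set (c ⊔ ℓ ⊔ ℓ′)
  Good n k = ∀ x a b → C B I n x → x ≈ a ∨ b → C B I k a ⊎ C B I k b

  module Classical (em : ExcludedMiddle (c ⊔ ℓ ⊔ ℓ′)) where

    dne : {P : Set (c ⊔ ℓ ⊔ ℓ′)} → ¬ ¬ P → P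
    dne = em⇒dne em

    -- If neither part of a split element of C n lies in C k, then the
    -- left part occurs at level k: otherwise it is zero and the right part,
    -- being the whole, lies in C k.
    part-occurs : ∀ {n k x a b} → n ≤ k → C B I n x → x ≈ a ∨ b
                → ¬ C B I k a → ¬ C B I k b → Occurs k a
    part-occurs n≤k x∈C x≈a∨b a∉C b∉C = dne λ a-absent →
      b∉C (C-resp-¬¬ (¬¬-absorb x≈a∨b λ a≢𝟘 → a∉C (¬Occurs⇒C a≢𝟘 a-absent))
                     (C-mono n≤k x∈C))

    no-split⇒good : ∀ {n k} → n ≤ k → ¬ Split n k → Good n k
    no-split⇒good {k = k} n≤k no-split x a b x∈C x≈a∨b with em {C B I k a} | em {C B I k b}
    ... | yes a∈C | _       = inj₁ a∈C
    ... | no _    | yes b∈C = inj₂ b∈C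
    ... | no a∉C  | no b∉C  = ⊥-elim (no-split record
      { whole = x ; left = a ; right = b ; whole∈C = x∈C ; whole≈ = x≈a∨b
      ; left-occurs = part-occurs n≤k x∈C x≈a∨b a∉C b∉C
      ; right-occurs = part-occurs n≤k x∈C (trans x≈a∨b (∨-comm a b)) b∉C a∉C })

    not-good⇒split : ∀ {n k} → n ≤ k → ¬ Good n k → Split n k
    not-good⇒split n≤k not-good = dne (not-good ∘ no-split⇒good n≤k)

    good-level : ∀ n → Σ ℕ λ k → n < k × Good n k
    good-level n with em {Σ ℕ λ k → n < k × Good n k}
    ... | yes found = found
    ... | no none = ⊥-elim (no-splits-forever n (λ j → suc n + j) (λ j → m≤n+m j (suc n))
      λ j → not-good⇒split (<⇒≤ (n<level j)) λ good → none (suc n + j , n<level j , good))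
      where
      n<level : ∀ j → n < suc n + j
      n<level j = s≤s (m≤m+n n j)

-- The theorem (Lemma 3.5).
lemma3p5 : {c ℓ ℓ′ : Level} → ExcludedMiddle (c ⊔ ℓ ⊔ ℓ′)
    → (B : BooleanAlgebra c ℓ)
    → ¬ (BooleanAlgebra._≈_ B (BooleanAlgebra.⊤ B) (BooleanAlgebra.⊥ B))
    → (I : Seq B → Set ℓ′) → MIdeal B I
    → ∀ (n : ℕ) → Σ ℕ λ k → n < k
        × (∀ (c a b : BooleanAlgebra.Carrier B) → C B I n c
            → BooleanAlgebra._≈_ B c (BooleanAlgebra._∨_ B a b)
            → C B I k a ⊎ C B I k b)
lemma3p5 em B _ I M = Development.Classical.good-level B I M em
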